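{- Let $m \ge 2$ and $x \geq 1$ be integers, let $G$ be a simple connected graph of order $n$, and let $D_m^x(G)$ be its $(m,x)$-shadow. Consider the following conditions, for some nonnegative integers $d'_x, \lambda'_x, \mu'_x$: (1) for all $v \in V(G)$, $|N(v)| + (m-1)|N^x(v)| = d'_x$; (2) for all $u,v \in V(G)$ with $u \sim v$ in $G$, $|N(u) \cap N(v)| + (m-1)|N^x(u) \cap N^x(v)| = \lambda'_x$; (3) for all $v,w \in V(G)$ with $w \in N^x(v)$, $|N(v) \cap N^x(w)| + |N^x(v) \cap N(w)| + (m-2)|N^x(v) \cap N^x(w)| = \lambda'_x$; (4) for all distinct $u,v \in V(G)$ with $u \not\sim v$ in $G$, $|N(u) \cap N(v)| + (m-1)|N^x(u) \cap N^x(v)| = \mu'_x$; (5) for all $v,w \in V(G)$ with $w \notin N^x(v)$, $|N(v) \cap N^x(w)| + |N^x(v) \cap N(w)| + (m-2)|N^x(v) \cap N^x(w)| = \mu'_x$. Then: condition (1) holds if and only if $D_m^x(G)$ is regular of degree $d'_x$; conditions (1), (2), (3) hold if and only if $D_m^x(G) \in ER(mn, d'_x, \lambda'_x)$; and conditions (1)–(5) all hold if and only if $D_m^x(G) \in SR(mn, d'_x, \lambda'_x, \mu'_x)$.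
   Context: All graphs are finite and simple. For a vertex $v$ of $G$, $N(v)$ is its neighborhood and, for a positive integer $x$, $N^x(v)$ is the set of vertices at distance exactly $x$ from $v$ in $G$. A graph is edge-regular if it is regular and there is $\lambda \ge 0$ such that every two adjacent vertices have exactly $\lambda$ common neighbors; $ER(n,d,\lambda)$ denotes the set of edge-regular graphs on $n$ vertices, regular of degree $d$, with parameter $\lambda$. $SR(n,d,\lambda,\mu)$ denotes the set of graphs in $ER(n,d,\lambda)$ in which any two distinct nonadjacent vertices have exactly $\mu$ common neighbors. For $x \ge 1$ and $m \ge 2$, the $(m,x)$-shadow $D_m^x(G)$ is the simple graph whose vertex set is the disjoint union of $m$ copies $G_1,\dots,G_m$ of $G$ (the copy of $u\in V(G)$ in $G_i$ denoted $u_i$), with edges $u_iv_i$ for $1\le i\le m$ and $uv \in E(G)$, and edges $u_iv_j$ for $1 \le i < j \le m$ whenever $u \in N^x(v)$. -}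

module Defs where

open import Data.Nat using (ℕ; zero; suc; _+_; _*_; _∸_)
open import Data.Bool using (Bool; true; false; _∧_; _∨_; not; if_then_else_)
open import Data.Fin using (Fin; remQuot) renaming (zero to fzero; suc to fsuc)
open import Data.Fin.Properties using () renaming (_≟_ to _≟ᶠ_)
open import Data.Product using (_×_; _,_; ∃)
open import Relation.Nullary using (¬_)
open import Relation.Nullary.Decidable using (⌊_⌋)
open import Relation.Binary.PropositionalEquality using (_≡_)

Graph : ℕ → Set
Graph n = Fin n → Fin n → Bool

IsSimple : ∀ {n} → Graph n → Set
IsSimple {n} G = (∀ u v → G u v ≡ G v u) × (∀ v → G v v ≡ false)

count : ∀ {n} → (Fin n → Bool) → ℕ
count {zero}  p = 0
count {suc n} p = (if p fzero then 1 else 0) + count (λ i → p (fsuc i))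

anyFin : ∀ {n} → (Fin n → Bool) → Bool
anyFin {zero}  p = false
anyFin {suc n} p = p fzero ∨ anyFin (λ i → p (fsuc i))

reach : ∀ {n} → Graph n → ℕ → Fin n → Fin n → Bool
reach G zero    u v = ⌊ u ≟ᶠ v ⌋
reach G (suc k) u v = reach G k u v ∨ anyFin (λ w → reach G k u w ∧ G w v)

-- atDist G x v w = true iff w ∈ N^x(v), i.e. dist(v,w) = x exactly.
atDist : ∀ {n} → Graph n → ℕ → Fin n → Fin n → Bool
atDist G zero    v w = ⌊ v ≟ᶠ w ⌋
atDist G (suc k) v w = reach G (suc k) v w ∧ not (reach G k v w)

Connected : ∀ {n} → Graph n → Set
Connected G = ∀ u v → ∃ λ k → reach G k u v ≡ true

deg : ∀ {n} → Graph n → Fin n → ℕ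
deg G v = count (G v)

common : ∀ {n} → Graph n → Fin n → Fin n → ℕ
common G u v = count (λ z → G u z ∧ G v z)

Regular : ∀ {n} → Graph n → ℕ → Set
Regular G d = ∀ v → deg G v ≡ d

IsER : ∀ {N} → Graph N → ℕ → ℕ → Set
IsER G d l = Regular G d × (∀ u v → G u v ≡ true → common G u v ≡ l)

IsSR : ∀ {N} → Graph N → ℕ → ℕ → ℕ → Set
IsSR G d l μ = IsER G d l × (∀ u v → ¬ (u ≡ v) → G u v ≡ false → common G u v ≡ μ)

-- The (m,x)-shadow D_m^x(G), on vertex set Fin (m * n); the vertex with
-- remQuot = (i , u) is the copy u_i of u in G_i.
-- u_i ~ v_i iff u ~ v; for i ≠ j, u_i ~ v_j iff u ∈ N^x(v).
shadow : ∀ {n} (m x : ℕ) → Graph n → Graph (m * n)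
shadow {n} m x G a b with remQuot {m} n a | remQuot {m} n b
... | (i , u) | (j , v) = if ⌊ i ≟ᶠ j ⌋ then G u v else atDist G x u v

nx : ∀ {n} → Graph n → ℕ → Fin n → ℕ
nx G x v = count (atDist G x v)

inter : ∀ {n} → (Fin n → Bool) → (Fin n → Bool) → ℕ
inter A B = count (λ z → A z ∧ B z)

Cond1 : ∀ {n} → Graph n → ℕ → ℕ → ℕ → Set
Cond1 G m x d = ∀ v → deg G v + (m ∸ 1) * nx G x v ≡ d

Cond2 : ∀ {n} → Graph n → ℕ → ℕ → ℕ → Set
Cond2 G m x l = ∀ u v → G u v ≡ true →
  inter (G u) (G v) + (m ∸ 1) * inter (atDist G x u) (atDist G x v) ≡ l

Cond3 : ∀ {n} → Graph n → ℕ → ℕ → ℕ → Set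
Cond3 G m x l = ∀ v w → atDist G x v w ≡ true →
  inter (G v) (atDist G x w) + inter (atDist G x v) (G w)
    + (m ∸ 2) * inter (atDist G x v) (atDist G x w) ≡ l

Cond4 : ∀ {n} → Graph n → ℕ → ℕ → ℕ → Set
Cond4 G m x μ = ∀ u v → ¬ (u ≡ v) → G u v ≡ false →
  inter (G u) (G v) + (m ∸ 1) * inter (atDist G x u) (atDist G x v) ≡ μ

Cond5 : ∀ {n} → Graph n → ℕ → ℕ → ℕ → Set
Cond5 G m x μ = ∀ v w → atDist G x v w ≡ false →
  inter (G v) (atDist G x w) + inter (atDist G x v) (G w)
    + (m ∸ 2) * inter (atDist G x v) (atDist G x w) ≡ μ

{-# OPTIONS --safe #-}
module Submission where

-- The vertex u_i of D_m^x(G) is adjacent to the copy in G_i of N(u) and to the copies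
-- of N^x(u) in the other m - 1 layers.  Counting (common) neighbours of u_i and v_j layer
-- by layer therefore sums m terms that are constant away from the layers i and j, which
-- gives the left-hand sides of (1), (2), (4) when i = j and of (3), (5) when i ≠ j.  As
-- m ≥ 2, every instance of (1)-(5) is realised in the layers 0 and 1.

open import Defs
open import Data.Nat using (ℕ; zero; suc; _+_; _*_; _∸_; _≤_; s≤s; z≤n)
open import Data.Nat.Properties using (+-assoc; <⇒≤; +-0-commutativeMonoid)
open import Data.Bool using (Bool; true; false; _∧_; if_then_else_)
open import Data.Fin using (Fin; combine; punchIn; punchOut; _↑ˡ_; _↑ʳ_)
  renaming (zero to fzero; suc to fsuc)
open import Data.Fin.Properties
  using (remQuot-combine; combine-surjective; combine-injectiveˡ; combine-injectiveʳ;
         punchIn-injective; punchInᵢ≢i; punchIn-punchOut; 0≢1+n)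
  renaming (_≟_ to _≟ᶠ_)
open import Data.Product using (_×_; _,_)
open import Data.Vec.Functional using (replicate)
open import Function.Base using (_∘_)
open import Function.Bundles using (_⇔_; mk⇔; module Equivalence)
open import Relation.Nullary using (yes; no)
open import Relation.Nullary.Decidable using (⌊_⌋; isYes≗does; dec-true; dec-false)
open import Relation.Binary.PropositionalEquality
  using (_≡_; _≢_; _≗_; refl; sym; trans; cong; cong₂; module ≡-Reasoning)
open import Algebra.Properties.CommutativeMonoid.Sum +-0-commutativeMonoid
  using (sum; sum-cong-≗; sum-remove)

open ≡-Reasoning

count-cong : ∀ {n} {p q : Fin n → Bool} → p ≗ q → count p ≡ count q
count-cong {zero}  p≗q = refl
count-cong {suc n} p≗q =
  cong₂ _+_ (cong (λ b → if b then 1 else 0) (p≗q fzero)) (count-cong (p≗q ∘ fsuc))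

count-↑ : ∀ a b (p : Fin (a + b) → Bool) →
          count p ≡ count (p ∘ (_↑ˡ b)) + count (p ∘ (a ↑ʳ_))
count-↑ zero    b p = refl
count-↑ (suc a) b p =
  trans (cong (p₀ +_) (count-↑ a b (p ∘ fsuc))) (sym (+-assoc p₀ _ _))
  where
  p₀ : ℕ
  p₀ = if p fzero then 1 else 0

count-combine : ∀ m {n} (p : Fin (m * n) → Bool) →
                count p ≡ sum (λ i → count (p ∘ combine {m} {n} i))
count-combine zero        p = refl
count-combine (suc m) {n} p =
  trans (count-↑ n (m * n) p) (cong (count (p ∘ (_↑ˡ m * n)) +_) (count-combine m (p ∘ (n ↑ʳ_))))

sum-replicate : ∀ m c → sum (replicate m c) ≡ m * c
sum-replicate zero    c = refl
sum-replicate (suc m) c = cong (c +_) (sum-replicate m c)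

sum-constant-off-point : ∀ {m} (f : Fin m → ℕ) (i : Fin m) {a c} →
                         f i ≡ a → (∀ k → i ≢ k → f k ≡ c) → sum f ≡ a + (m ∸ 1) * c
sum-constant-off-point {suc m} f i {a} {c} fi≡a f≡c = begin
  sum f                     ≡⟨ sum-remove {i = i} f ⟩
  f i + sum (f ∘ punchIn i) ≡⟨ cong₂ _+_ fi≡a (sum-cong-≗ (λ k → f≡c _ (punchIn≢i k))) ⟩
  a + sum (replicate m c)   ≡⟨ cong (a +_) (sum-replicate m c) ⟩
  a + m * c                 ∎
  where
  punchIn≢i : ∀ k → i ≢ punchIn i k
  punchIn≢i k = punchInᵢ≢i i k ∘ sym

sum-constant-off-two-points : ∀ {m} (f : Fin m → ℕ) {i j : Fin m} {a b c} → i ≢ j →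
                              f i ≡ a → f j ≡ b → (∀ k → i ≢ k → j ≢ k → f k ≡ c) →
                              sum f ≡ a + b + (m ∸ 2) * c
sum-constant-off-two-points {suc m} f {i} {j} {a} {b} {c} i≢j fi≡a fj≡b f≡c = begin
  sum f                     ≡⟨ sum-remove {i = i} f ⟩
  f i + sum (f ∘ punchIn i) ≡⟨ cong (_+ sum (f ∘ punchIn i)) fi≡a ⟩
  a + sum (f ∘ punchIn i)   ≡⟨ cong (a +_) (sum-constant-off-point _ j′ fj′≡b f≡c′) ⟩
  a + (b + (m ∸ 1) * c)     ≡⟨ sym (+-assoc a b _) ⟩
  a + b + (m ∸ 1) * c       ∎
  where
  j′ : Fin m
  j′ = punchOut i≢j

  fj′≡b : f (punchIn i j′) ≡ b
  fj′≡b = trans (cong f (punchIn-punchOut i≢j)) fj≡b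

  f≡c′ : ∀ k → j′ ≢ k → f (punchIn i k) ≡ c
  f≡c′ k j′≢k = f≡c (punchIn i k) (punchInᵢ≢i i k ∘ sym)
    (λ j≡ik → j′≢k (punchIn-injective i j′ k (trans (punchIn-punchOut i≢j) j≡ik)))

∀-combine : ∀ {m n} {P : Fin (m * n) → Set} → (∀ i u → P (combine i u)) → ∀ a → P a
∀-combine {m} {n} P-combine a with i , u , refl ← combine-surjective {m} {n} a = P-combine i u

AdjacentCommon : ∀ {N} → Graph N → ℕ → Set
AdjacentCommon H l = ∀ a b → H a b ≡ true → common H a b ≡ l

NonAdjacentCommon : ∀ {N} → Graph N → ℕ → Set
NonAdjacentCommon H μ = ∀ a b → a ≢ b → H a b ≡ false → common H a b ≡ μ

module _ {n} (m x : ℕ) (G : Graph n) where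

  private
    D : Graph (m * n)
    D = shadow m x G

    Nˣ : Fin n → Fin n → Bool
    Nˣ = atDist G x

  shadow-combine : ∀ i j u v →
                   D (combine i u) (combine j v) ≡ (if ⌊ i ≟ᶠ j ⌋ then G u v else Nˣ u v)
  shadow-combine i j u v = cong₂ adjacency (remQuot-combine i u) (remQuot-combine j v)
    where
    adjacency : Fin m × Fin n → Fin m × Fin n → Bool
    adjacency (i , u) (j , v) = if ⌊ i ≟ᶠ j ⌋ then G u v else Nˣ u v

  shadow-within : ∀ i u v → D (combine i u) (combine i v) ≡ G u v
  shadow-within i u v
    rewrite shadow-combine i i u v | isYes≗does (i ≟ᶠ i) | dec-true (i ≟ᶠ i) refl = refl

  shadow-across : ∀ {i j} → i ≢ j → ∀ u v → D (combine i u) (combine j v) ≡ Nˣ u v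
  shadow-across {i} {j} i≢j u v
    rewrite shadow-combine i j u v | isYes≗does (i ≟ᶠ j) | dec-false (i ≟ᶠ j) i≢j = refl

  deg-shadow : ∀ i u → deg D (combine i u) ≡ deg G u + (m ∸ 1) * nx G x u
  deg-shadow i u = trans (count-combine m (D (combine i u)))
    (sum-constant-off-point _ i (count-cong (shadow-within i u))
      (λ k i≢k → count-cong (shadow-across i≢k u)))

  common-shadow-within : ∀ i u v → common D (combine i u) (combine i v)
                         ≡ inter (G u) (G v) + (m ∸ 1) * inter (Nˣ u) (Nˣ v)
  common-shadow-within i u v = trans (count-combine m _)
    (sum-constant-off-point _ i
      (count-cong (λ z → cong₂ _∧_ (shadow-within i u z) (shadow-within i v z)))
      (λ k i≢k → count-cong (λ z → cong₂ _∧_ (shadow-across i≢k u z) (shadow-across i≢k v z))))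

  common-shadow-across : ∀ {i j} → i ≢ j → ∀ u v → common D (combine i u) (combine j v)
                         ≡ inter (G u) (Nˣ v) + inter (Nˣ u) (G v) + (m ∸ 2) * inter (Nˣ u) (Nˣ v)
  common-shadow-across i≢j u v = trans (count-combine m _)
    (sum-constant-off-two-points _ i≢j
      (count-cong (λ z → cong₂ _∧_ (shadow-within _ u z) (shadow-across (i≢j ∘ sym) v z)))
      (count-cong (λ z → cong₂ _∧_ (shadow-across i≢j u z) (shadow-within _ v z)))
      (λ k i≢k j≢k → count-cong (λ z → cong₂ _∧_ (shadow-across i≢k u z) (shadow-across j≢k v z))))

  cond1⇒regular : ∀ {d} → Cond1 G m x d → Regular D d
  cond1⇒regular c1 = ∀-combine (λ i u → trans (deg-shadow i u) (c1 u))

  regular⇒cond1 : ∀ {d} → Fin m → Regular D d → Cond1 G m x d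
  regular⇒cond1 i reg u = trans (sym (deg-shadow i u)) (reg (combine i u))

  cond2×cond3⇒adjacentCommon : ∀ {l} → Cond2 G m x l → Cond3 G m x l → AdjacentCommon D l
  cond2×cond3⇒adjacentCommon {l} c2 c3 =
    ∀-combine λ i u → ∀-combine λ j v → adjacent i u j v
    where
    adjacent : ∀ i u j v → D (combine i u) (combine j v) ≡ true →
               common D (combine i u) (combine j v) ≡ l
    adjacent i u j v adj with i ≟ᶠ j
    ... | yes refl = trans (common-shadow-within i u v)
                       (c2 u v (trans (sym (shadow-within i u v)) adj))
    ... | no i≢j   = trans (common-shadow-across i≢j u v)
                       (c3 u v (trans (sym (shadow-across i≢j u v)) adj))

  adjacentCommon⇒cond2 : ∀ {l} → Fin m → AdjacentCommon D l → Cond2 G m x l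
  adjacentCommon⇒cond2 i adj u v uv = trans (sym (common-shadow-within i u v))
    (adj (combine i u) (combine i v) (trans (shadow-within i u v) uv))

  adjacentCommon⇒cond3 : ∀ {l} {i j : Fin m} → i ≢ j → AdjacentCommon D l → Cond3 G m x l
  adjacentCommon⇒cond3 {i = i} {j} i≢j adj v w vw = trans (sym (common-shadow-across i≢j v w))
    (adj (combine i v) (combine j w) (trans (shadow-across i≢j v w) vw))

  cond4×cond5⇒nonAdjacentCommon : ∀ {μ} → Cond4 G m x μ → Cond5 G m x μ → NonAdjacentCommon D μ
  cond4×cond5⇒nonAdjacentCommon {μ} c4 c5 =
    ∀-combine λ i u → ∀-combine λ j v → nonAdjacent i u j v
    where
    nonAdjacent : ∀ i u j v → combine i u ≢ combine j v → D (combine i u) (combine j v) ≡ false →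
                  common D (combine i u) (combine j v) ≡ μ
    nonAdjacent i u j v iu≢jv nadj with i ≟ᶠ j
    ... | yes refl = trans (common-shadow-within i u v)
                       (c4 u v (iu≢jv ∘ cong (combine i)) (trans (sym (shadow-within i u v)) nadj))
    ... | no i≢j   = trans (common-shadow-across i≢j u v)
                       (c5 u v (trans (sym (shadow-across i≢j u v)) nadj))

  nonAdjacentCommon⇒cond4 : ∀ {μ} → Fin m → NonAdjacentCommon D μ → Cond4 G m x μ
  nonAdjacentCommon⇒cond4 i nadj u v u≢v uv = trans (sym (common-shadow-within i u v))
    (nadj (combine i u) (combine i v) (u≢v ∘ combine-injectiveʳ i u i v)
          (trans (shadow-within i u v) uv))

  nonAdjacentCommon⇒cond5 : ∀ {μ} {i j : Fin m} → i ≢ j → NonAdjacentCommon D μ → Cond5 G m x μ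
  nonAdjacentCommon⇒cond5 {i = i} {j} i≢j nadj v w vw = trans (sym (common-shadow-across i≢j v w))
    (nadj (combine i v) (combine j w) (i≢j ∘ combine-injectiveˡ i v j w)
          (trans (shadow-across i≢j v w) vw))

shadow-regular⇔ : ∀ {n} m x (G : Graph n) d → 1 ≤ m → Cond1 G m x d ⇔ Regular (shadow m x G) d
shadow-regular⇔ m x G d (s≤s z≤n) = mk⇔ (cond1⇒regular m x G) (regular⇒cond1 m x G fzero)

shadow-edgeRegular⇔ : ∀ {n} m x (G : Graph n) d l → 2 ≤ m →
                      (Cond1 G m x d × Cond2 G m x l × Cond3 G m x l) ⇔ IsER (shadow m x G) d l
shadow-edgeRegular⇔ m x G d l (s≤s (s≤s z≤n)) = mk⇔
  (λ (c1 , c2 , c3) → cond1⇒regular m x G c1 , cond2×cond3⇒adjacentCommon m x G c2 c3)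
  (λ (reg , adj) → regular⇒cond1 m x G fzero reg
                 , adjacentCommon⇒cond2 m x G fzero adj
                 , adjacentCommon⇒cond3 m x G (0≢1+n {i = fzero}) adj)

shadow-stronglyRegular⇔ : ∀ {n} m x (G : Graph n) d l μ → 2 ≤ m →
                          (Cond1 G m x d × Cond2 G m x l × Cond3 G m x l × Cond4 G m x μ × Cond5 G m x μ)
                          ⇔ IsSR (shadow m x G) d l μ
shadow-stronglyRegular⇔ m x G d l μ 2≤m@(s≤s (s≤s z≤n)) = mk⇔
  (λ (c1 , c2 , c3 , c4 , c5) → to (c1 , c2 , c3) , cond4×cond5⇒nonAdjacentCommon m x G c4 c5)
  (λ (er , nadj) → let (c1 , c2 , c3) = from er in
     c1 , c2 , c3 , nonAdjacentCommon⇒cond4 m x G fzero nadj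
                  , nonAdjacentCommon⇒cond5 m x G (0≢1+n {i = fzero}) nadj)
  where open Equivalence (shadow-edgeRegular⇔ m x G d l 2≤m)

theorem2p6 : (m x n : ℕ) → 2 ≤ m → 1 ≤ x → (G : Graph n) → IsSimple G → Connected G →
    (d l μ : ℕ) →
      (Cond1 G m x d ⇔ Regular (shadow m x G) d)
      × ((Cond1 G m x d × Cond2 G m x l × Cond3 G m x l) ⇔ IsER (shadow m x G) d l)
      × ((Cond1 G m x d × Cond2 G m x l × Cond3 G m x l × Cond4 G m x μ × Cond5 G m x μ)
          ⇔ IsSR (shadow m x G) d l μ)
theorem2p6 m x n 2≤m _ G _ _ d l μ =
    shadow-regular⇔ m x G d (<⇒≤ 2≤m)
  , shadow-edgeRegular⇔ m x G d l 2≤m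
  , shadow-stronglyRegular⇔ m x G d l μ 2≤m
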